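{- Let $T$ be a tree, $v$ a core of $T$, and $L\subseteq V$ a set that contains a local set of $v$. Let $x\neq y$ be vertices of the subtree consisting of $v$ together with its g-legs, such that $x,y\notin L$ and $d(x,v)<d(y,v)$. Then every vertex of $L$, except possibly the vertices lying on the g-leg of $v$ that contains $y$, separates $x$ and $y$.
   Context: Let $T=(V,E)$ be a finite tree and $d(x,y)$ the number of edges on the path between $x$ and $y$. A vertex $\tau$ separates $u$ and $w$ if $d(u,\tau)\neq d(w,\tau)$. A core is a vertex of degree at least $3$. For a vertex $v$, the subtrees of the neighbors of $v$ are the connected components of $T-v$. A (standard) leg of a core $v$ is a subtree of a neighbor of $v$ containing no core (a path attached to $v$); it is short if it has one vertex and long otherwise. For a leg $\ell$ of $v$, $\ell^i$ denotes the vertex of $\ell$ at distance $i$ from $v$ (its position is $i$). A small core is a core of degree exactly $3$ with at least two legs, at least one of which is short; other cores are regular. A modified leg of a core $v$ is a subtree of a neighbor of $v$ containing exactly one core, which is a small core $w$; the position of a vertex on it is its distance from $v$; if $w$ has position $i$, the two vertices of position $i+1$ are $\ell^a,\ell^b$, where $\ell^b$ is the vertex of a short leg of $w$ (chosen arbitrarily if both legs of $w$ inside $\ell$ are short). A g-leg of $v$ is a standard leg or a modified leg of $v$. Solution types. For a set $S$ and a standard leg $\ell$, $S\cap\ell$ is of type $(s,0)$ if empty; $(s,1)$ if it is a single vertex of position at least $2$; $(s,2)$ if it has at least two vertices; $(s,3)$ if it equals $\{\ell^1\}$. For a modified leg $\ell$ whose small core has position $i$: type $(m,1)$ if $S\cap\ell$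 equals $\{\ell^a\}$ or $\{\ell^b\}$; type $(m,2)$ if it contains neither $\ell^a$ nor $\ell^b$ and contains at least two vertices of position at least $i+2$; type $(m,3)$ if it has at least two vertices, at least one of which is $\ell^a$ or $\ell^b$. A local set of a core $v$ is a set $S$ of vertices of the g-legs of $v$ (so $v\notin S$) such that: (1) at most one standard leg has type $(s,0)$ and all other standard legs have type $(s,1)$, $(s,2)$ or $(s,3)$; (2) every modified leg has type $(m,1)$, $(m,2)$ or $(m,3)$; (3) if some standard leg has type $(s,0)$ then no modified leg has type $(m,1)$; (4) if some long leg $\ell$ has type $(s,0)$ then every long leg other than $\ell$ has type $(s,2)$; (5) if some short leg has type $(s,0)$ then every long leg has type $(s,2)$ or $(s,3)$. -}

module Defs where

open import Data.Nat using (ℕ; zero; suc; _≤_; _<_)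
open import Data.Bool using (Bool; T)
open import Data.Fin using (Fin)
open import Data.Fin.Subset using (Subset; _∈_; _∉_; ∣_∣)
open import Data.Vec using (tabulate)
open import Data.List using (List; []; _∷_; length)
open import Data.List.Relation.Unary.All using (All)
open import Data.List.Relation.Unary.Unique.Propositional using (Unique)
open import Data.Product using (Σ; ∃; ∃-syntax; _×_; _,_)
open import Data.Sum using (_⊎_)
open import Data.Empty using (⊥)
open import Relation.Nullary using (¬_)
open import Relation.Binary.PropositionalEquality using (_≡_; _≢_)

-- Walks: Walk E x y vs means vs is the list of vertices of a walk from x to y.
data Walk {n : ℕ} (E : Fin n → Fin n → Set) : Fin n → Fin n → List (Fin n) → Set where
  here : ∀ {x} → Walk E x x (x ∷ [])
  step : ∀ {x y z vs} → E x y → Walk E y z vs → Walk E x z (x ∷ vs)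

module _ {n : ℕ} (adj : Fin n → Fin n → Bool) where

  E : Fin n → Fin n → Set
  E x y = T (adj x y)

  record IsTree : Set where
    field
      symmetric  : ∀ x y → adj x y ≡ adj y x
      irreflexive : ∀ x → ¬ E x x
      connected  : ∀ x y → ∃[ vs ] Walk E x y vs
      acyclic    : ∀ x y vs → Walk E x y vs → Unique vs → 3 ≤ length vs → E y x → ⊥

  -- Dist x y k : the path between x and y has k edges
  -- (a path = walk without repeated vertices; unique in a tree)
  Dist : Fin n → Fin n → ℕ → Set
  Dist x y k = ∃[ vs ] (Walk E x y vs × Unique vs × length vs ≡ suc k)

  Separates : Fin n → Fin n → Fin n → Set
  Separates τ u w = ∀ a b → Dist u τ a → Dist w τ b → a ≢ b

  degree : Fin n → ℕ
  degree v = ∣ tabulate (adj v) ∣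

  IsCore : Fin n → Set
  IsCore v = 3 ≤ degree v

  -- Comp v u w : w lies in the connected component of T - v containing u
  -- (for u a neighbour of v: the subtree of the neighbour u of v)
  Comp : Fin n → Fin n → Fin n → Set
  Comp v u w = ∃[ vs ] (Walk E u w vs × All (_≢ v) vs)

  -- standard leg of v (identified by the neighbour u of v it starts at)
  StdLeg : Fin n → Fin n → Set
  StdLeg v u = E v u × (∀ w → Comp v u w → ¬ IsCore w)

  ShortLeg : Fin n → Fin n → Set
  ShortLeg v u = StdLeg v u × (∀ w → Comp v u w → w ≡ u)

  LongLeg : Fin n → Fin n → Set
  LongLeg v u = StdLeg v u × ∃[ w ] (Comp v u w × w ≢ u)

  IsSmallCore : Fin n → Set
  IsSmallCore w = IsCore w × degree w ≡ 3 ×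
    ∃[ u₁ ] ∃[ u₂ ] (u₁ ≢ u₂ × ShortLeg w u₁ × StdLeg w u₂)

  ModLegAt : Fin n → Fin n → Fin n → Set
  ModLegAt v u w = E v u × Comp v u w × IsSmallCore w ×
    (∀ z → Comp v u z → IsCore z → z ≡ w)

  ModLeg : Fin n → Fin n → Set
  ModLeg v u = ∃[ w ] ModLegAt v u w

  GLeg : Fin n → Fin n → Set
  GLeg v u = StdLeg v u ⊎ ModLeg v u

  InStar : Fin n → Fin n → Set
  InStar v z = z ≡ v ⊎ ∃[ u ] (GLeg v u × Comp v u z)

  module _ (S : Subset n) (v u : Fin n) where

    Single : Fin n → Set
    Single x = Comp v u x × x ∈ S × (∀ z → Comp v u z → z ∈ S → z ≡ x)

    TwoIn : Set
    TwoIn = ∃[ x ] ∃[ y ] (x ≢ y × Comp v u x × Comp v u y × x ∈ S × y ∈ S)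

    TypeS0 TypeS1 TypeS2 TypeS3 : Set
    TypeS0 = ∀ z → Comp v u z → z ∉ S
    TypeS1 = ∃[ x ] (Single x × ∃[ k ] (Dist v x k × 2 ≤ k))
    TypeS2 = TwoIn
    TypeS3 = ∃[ x ] (Single x × Dist v x 1)

    -- i is the position of the small core of the modified leg;
    -- InA z : z is ℓ^a or ℓ^b (the vertices of position i+1)
    module _ (i : ℕ) where
      InA : Fin n → Set
      InA z = Comp v u z × Dist v z (suc i)

      TypeM1 TypeM2 TypeM3 : Set
      TypeM1 = ∃[ x ] (Single x × InA x)
      TypeM2 = (∀ z → InA z → z ∉ S) ×
        ∃[ x ] ∃[ y ] (x ≢ y × Comp v u x × Comp v u y × x ∈ S × y ∈ S ×
          ∃[ k ] (Dist v x k × suc (suc i) ≤ k) ×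
          ∃[ k ] (Dist v y k × suc (suc i) ≤ k))
      TypeM3 = ∃[ x ] ∃[ y ] (x ≢ y × Comp v u x × Comp v u y × x ∈ S × y ∈ S ×
          (InA x ⊎ InA y))

  record LocalSet (S : Subset n) (v : Fin n) : Set where
    field
      inGLegs : ∀ z → z ∈ S → ∃[ u ] (GLeg v u × Comp v u z)
      cond1a  : ∀ u u′ → StdLeg v u → StdLeg v u′ →
                TypeS0 S v u → TypeS0 S v u′ → u ≡ u′
      cond1b  : ∀ u → StdLeg v u →
                TypeS0 S v u ⊎ TypeS1 S v u ⊎ TypeS2 S v u ⊎ TypeS3 S v u
      cond2   : ∀ u w i → ModLegAt v u w → Dist v w i →
                TypeM1 S v u i ⊎ TypeM2 S v u i ⊎ TypeM3 S v u i
      cond3   : ∀ u → StdLeg v u → TypeS0 S v u →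
                ∀ u′ w i → ModLegAt v u′ w → Dist v w i → ¬ TypeM1 S v u′ i
      cond4   : ∀ u → LongLeg v u → TypeS0 S v u →
                ∀ u′ → LongLeg v u′ → u′ ≢ u → TypeS2 S v u′
      cond5   : ∀ u → ShortLeg v u → TypeS0 S v u →
                ∀ u′ → LongLeg v u′ → TypeS2 S v u′ ⊎ TypeS3 S v u′

module Submission where

-- Let τ ∈ L lie outside the g-leg (the component of
-- T - v at the neighbour u) containing y.  Then the path from y to τ must
-- pass through v, so d(y,τ) = d(y,v) + d(v,τ).  On the other hand the
-- triangle inequality gives d(x,τ) ≤ d(x,v) + d(v,τ), and d(x,v) < d(y,v)
-- by hypothesis; hence d(x,τ) < d(y,τ) and τ separates x and y.

open import Defs
open import Data.Nat using (ℕ; _<_; _≤_; _+_; suc; z≤n; s≤s; s≤s⁻¹)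
open import Data.Nat.Properties
  using (≤-refl; ≤-trans; n≤1+n; +-comm; +-monoˡ-<; <-irrefl; suc-injective; module ≤-Reasoning)
open import Data.Bool using (Bool; T)
open import Data.Fin using (Fin)
open import Data.Fin.Properties using (_≟_)
open import Data.Fin.Subset using (Subset; _∈_; _∉_; _⊆_)
open import Data.List using ([]; _∷_; _++_; length)
open import Data.List.Properties using (length-++; length-++-sucʳ; length-++-≤ʳ)
open import Data.List.Relation.Unary.All using (All; []; _∷_; head; tabulate; lookup)
open import Data.List.Relation.Unary.All.Properties using (++⁺; ++⁻ˡ; ++⁻ʳ; ¬Any⇒All¬)
open import Data.List.Relation.Unary.Any using (here; there; any?)
open import Data.List.Relation.Unary.AllPairs using ([]; _∷_)
open import Data.List.Relation.Unary.Unique.Propositional using (Unique)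
open import Data.Product using (∃-syntax; _×_; _,_; proj₂)
open import Data.Sum using (_⊎_; inj₁; inj₂)
open import Data.Empty using (⊥-elim)
open import Function using (id)
open import Relation.Nullary using (¬_; yes; no)
open import Relation.Binary.PropositionalEquality using (_≡_; _≢_; refl; sym; trans; cong; cong₂; subst; module ≡-Reasoning)

unique-split : ∀ {A : Set} pre {post} {v : A} → Unique (pre ++ v ∷ post) →
               Unique (pre ++ v ∷ []) × Unique (v ∷ post)
unique-split []        u       = ([] ∷ []) , u
unique-split (p ∷ pre) (a ∷ u) with unique-split pre u
... | u₁ , u₂ = (++⁺ (++⁻ˡ pre a) (head (++⁻ʳ pre a) ∷ []) ∷ u₁) , u₂

module WalkLemmas {n : ℕ} {E : Fin n → Fin n → Set} where
  open import Data.List.Membership.Propositional using () renaming (_∈_ to _∈ₗ_)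
  open import Data.List.Membership.Propositional.Properties using (∈-++⁻; ∈-++⁺ʳ; ∈-∃++)
  open import Data.List.Relation.Binary.Subset.Propositional using () renaming (_⊆_ to _⊆ₗ_)

  walk-source : ∀ {x y vs} → Walk E x y vs → ∃[ ws ] (vs ≡ x ∷ ws)
  walk-source here       = [] , refl
  walk-source (step _ _) = _ , refl

  walk-target : ∀ {x y vs} → Walk E x y vs → y ∈ₗ vs
  walk-target here       = here refl
  walk-target (step _ w) = there (walk-target w)

  join : ∀ {x y z vs ws} → Walk E x y vs → Walk E y z (y ∷ ws) → Walk E x z (vs ++ ws)
  join here        w₂ = w₂
  join (step e w₁) w₂ = step e (join w₁ w₂)

  split-walk : ∀ pre {post x z v} → Walk E x z (pre ++ v ∷ post) →
               Walk E x v (pre ++ v ∷ []) × Walk E v z (v ∷ post)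
  split-walk []          here        = here , here
  split-walk []          (step e w)  = here , step e w
  split-walk (_ ∷ [])    (step e w)  with split-walk [] w
  ... | w₁ , w₂ = step e w₁ , w₂
  split-walk (_ ∷ p ∷ pre) (step e w) with split-walk (p ∷ pre) w
  ... | w₁ , w₂ = step e w₁ , w₂

  distinct-ends-length : ∀ {x y vs} → x ≢ y → Walk E x y vs → 2 ≤ length vs
  distinct-ends-length x≢y here                = ⊥-elim (x≢y refl)
  distinct-ends-length _   (step _ here)       = s≤s (s≤s z≤n)
  distinct-ends-length _   (step _ (step _ _)) = s≤s (s≤s z≤n)

  shortcut : ∀ {x y vs} → Walk E x y vs →
             ∃[ ps ] (Walk E x y ps × Unique ps × ps ⊆ₗ vs × length ps ≤ length vs)
  shortcut here = _ , here , ([] ∷ []) , id , ≤-refl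
  shortcut {x = x} (step e w) with shortcut w
  ... | ps , w′ , u , sub , len with any? (x ≟_) ps
  ...   | no x∉ps = x ∷ ps , step e w′ , ¬Any⇒All¬ ps x∉ps ∷ u ,
                    (λ { (here p) → here p ; (there m) → there (sub m) }) , s≤s len
  ...   | yes x∈ps with ∈-∃++ x∈ps
  ...     | pre , post , refl =
    x ∷ post , proj₂ (split-walk pre w′) , proj₂ (unique-split pre u) ,
    (λ m → there (sub (∈-++⁺ʳ pre m))) ,
    ≤-trans (length-++-≤ʳ (x ∷ post) {pre}) (≤-trans len (n≤1+n _))

  reverse-walk : (∀ {a b} → E a b → E b a) → ∀ {x y vs} → Walk E x y vs →
                 ∃[ ws ] (Walk E y x (y ∷ ws) × (y ∷ ws) ⊆ₗ vs)
  reverse-walk sym-E here = [] , here , id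
  reverse-walk sym-E {x = x} {z} (step {vs = vs} e w) with reverse-walk sym-E w
  ... | ws , w′ , sub = ws ++ x ∷ [] , join w′ (step (sym-E e) here) , back
    where
      back : (z ∷ ws ++ x ∷ []) ⊆ₗ (x ∷ vs)
      back m with ∈-++⁻ (z ∷ ws) m
      ... | inj₁ m′        = there (sub m′)
      ... | inj₂ (here p)  = here p

open WalkLemmas

module _ {n : ℕ} (adj : Fin n → Fin n → Bool) where
  open import Data.List.Membership.Propositional using () renaming (_∈_ to _∈ₗ_)

  comp-step : ∀ {v u y y′} → Comp adj v u y → E adj y y′ → y′ ≢ v → Comp adj v u y′
  comp-step (cs , wc , allc) e y′≢v = _ , join wc (step e here) , ++⁺ allc (y′≢v ∷ [])

  walk-exits-through : ∀ {v u y τ ws} → Comp adj v u y → Walk (E adj) y τ ws →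
                       ¬ Comp adj v u τ → v ∈ₗ ws
  walk-exits-through c here τ∉C = ⊥-elim (τ∉C c)
  walk-exits-through {v = v} c (step {y = y′} e w) τ∉C with y′ ≟ v
  ... | no y′≢v   = there (walk-exits-through (comp-step c e y′≢v) w τ∉C)
  ... | yes refl  with walk-source w
  ...   | _ , refl = there (here refl)

module TreeMetric {n : ℕ} (adj : Fin n → Fin n → Bool) (tree : IsTree adj) where
  open IsTree tree
  open import Data.List.Membership.Propositional using () renaming (_∈_ to _∈ₗ_)
  open import Data.List.Membership.Propositional.Properties using (∈-++⁻; ∈-∃++)

  edge-sym : ∀ {x y} → E adj x y → E adj y x
  edge-sym {x} {y} = subst T (symmetric x y)

  -- Paths are unique: two paths with the same ends that diverge after the
  -- first vertex x, at distinct neighbours y₁ and y₂, would give a path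
  -- y₁ ⋯ y₂ avoiding x, closing a cycle x y₁ ⋯ y₂ x.
  path-unique : ∀ {x z ps qs} → Walk (E adj) x z ps → Unique ps →
                Walk (E adj) x z qs → Unique qs → ps ≡ qs
  path-unique here       _       here       _       = refl
  path-unique here       _       (step _ w) (a ∷ _) = ⊥-elim (lookup a (walk-target w) refl)
  path-unique (step _ w) (a ∷ _) here       _       = ⊥-elim (lookup a (walk-target w) refl)
  path-unique {x = x} (step {y = y₁} {vs = ps₁} e₁ w₁) (a₁ ∷ u₁) (step {y = y₂} e₂ w₂) (a₂ ∷ u₂)
    with y₁ ≟ y₂
  ... | yes refl = cong (x ∷_) (path-unique w₁ u₁ w₂ u₂)
  ... | no y₁≢y₂ with reverse-walk edge-sym w₂
  ...   | rs , r , r⊆ with shortcut (join w₁ r)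
  ...     | cs , c , c-unique , c⊆ , _ =
    ⊥-elim (acyclic x y₂ (x ∷ cs) (step e₁ c) (x-avoided ∷ c-unique)
            (s≤s (distinct-ends-length y₁≢y₂ c)) (edge-sym e₂))
    where
      x-avoided : All (x ≢_) cs
      x-avoided = tabulate λ m → avoid (∈-++⁻ _ (c⊆ m))
        where
          avoid : ∀ {z} → z ∈ₗ ps₁ ⊎ z ∈ₗ rs → x ≢ z
          avoid (inj₁ m) = lookup a₁ m
          avoid (inj₂ m) = lookup a₂ (r⊆ (there m))

  dist-functional : ∀ {x y a b} → Dist adj x y a → Dist adj x y b → a ≡ b
  dist-functional (ps , wp , up , lp) (qs , wq , uq , lq) =
    suc-injective (trans (sym lp) (trans (cong length (path-unique wp up wq uq)) lq))

  -- Triangle inequality: the concatenated walk x ⋯ v ⋯ τ contains a path.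
  triangle : ∀ {x v τ a c p} → Dist adj x v a → Dist adj v τ c → Dist adj x τ p → p ≤ a + c
  triangle {a = a} {c} {p} (xs , wx , _ , lx) (vs , wv , _ , lv) (ps , wp , up , lp)
    with walk-source wv
  ... | post , refl with shortcut (join wx wv)
  ...   | qs , wq , uq , _ , len = s≤s⁻¹ (begin
      suc p                   ≡⟨ sym lp ⟩
      length ps               ≡⟨ cong length (path-unique wp up wq uq) ⟩
      length qs               ≤⟨ len ⟩
      length (xs ++ post)     ≡⟨ length-++ xs ⟩
      length xs + length post ≡⟨ cong₂ _+_ lx (suc-injective lv) ⟩
      suc (a + c)             ∎)
    where open ≤-Reasoning

  dist-through : ∀ {y τ v q qs} → Walk (E adj) y τ qs → Unique qs → length qs ≡ suc q →
                 v ∈ₗ qs → ∃[ b ] ∃[ c ] (Dist adj y v b × Dist adj v τ c × q ≡ b + c)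
  dist-through {v = v} {q} wq uq lq v∈qs with ∈-∃++ v∈qs
  ... | pre , post , refl with split-walk pre {post} wq | unique-split pre uq
  ...   | w₁ , w₂ | u₁ , u₂ =
    length pre , length post ,
    (_ , w₁ , u₁ , trans (length-++ pre) (+-comm (length pre) 1)) ,
    (_ , w₂ , u₂ , refl) ,
    suc-injective (begin
      suc q                           ≡⟨ sym lq ⟩
      length (pre ++ v ∷ post)        ≡⟨ length-++-sucʳ pre v post ⟩
      suc (length (pre ++ post))      ≡⟨ cong suc (length-++ pre) ⟩
      suc (length pre + length post)  ∎)
    where open ≡-Reasoning

open TreeMetric

claim1 : ∀ {n : ℕ} (adj : Fin n → Fin n → Bool) → IsTree adj →
    (v : Fin n) → IsCore adj v →
    (L : Subset n) → (∃[ S ] (LocalSet adj S v × S ⊆ L)) →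
    (x y : Fin n) → x ≢ y → InStar adj v x → InStar adj v y →
    x ∉ L → y ∉ L →
    (∃[ a ] ∃[ b ] (Dist adj x v a × Dist adj y v b × a < b)) →
    (u : Fin n) → GLeg adj v u → Comp adj v u y →
    (τ : Fin n) → τ ∈ L → ¬ Comp adj v u τ → Separates adj τ x y
claim1 adj tree _ _ _ _ _ _ _ _ _ _ _ (a , b , x~v , y~v , a<b) _ _ y∈C _ _ τ∉C
       p q x~τ (qs , wq , uq , lq) p≡q
  with dist-through adj tree wq uq lq (walk-exits-through adj y∈C wq τ∉C)
... | b′ , c , y~v′ , v~τ , q≡b′+c = <-irrefl p≡q (begin-strict
    p      ≤⟨ triangle adj tree x~v v~τ x~τ ⟩
    a + c  <⟨ +-monoˡ-< c a<b ⟩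
    b + c  ≡⟨ cong (_+ c) (dist-functional adj tree y~v y~v′) ⟩
    b′ + c ≡⟨ sym q≡b′+c ⟩
    q      ∎)
  where open ≤-Reasoning
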